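{- Let $k,n,s$ be positive integers and let $x_1,\dots,x_n$ be independent variables. Then \[ \sum_{j=0}^{k}e_j(x_1,\ldots,x_n)\,h_{k-j}(x_1,\ldots,x_n)=\sum_{j=0}^{k}M^{(s)}_j(x_1,\ldots,x_n)\,E^{(s)}_{k-j}(x_1,\ldots,x_n). \]
   Context: $M_{m}^{(s)}(x_{1},\ldots,x_{n})=\sum x_{1}^{a_{1}}\cdots x_{n}^{a_{n}}$, the sum over all $n$-tuples of nonnegative integers with $a_1+\cdots+a_n=m$ and each $a_i\equiv 0$ or $1 \pmod{s+1}$. $E_m^{(s)}(x_1,\dots,x_n)=\sum x_1^{a_1}\cdots x_n^{a_n}$, the sum over all $n$-tuples of nonnegative integers with $a_1+\cdots+a_n=m$ and each $a_i\le s$. $h_j$ and $e_j$ are the complete homogeneous and elementary symmetric polynomials. -}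

module Defs where

open import Algebra.Bundles using (CommutativeRing)
open import Data.Nat using (ℕ; zero; suc; _∸_; _≤ᵇ_; _%_)
open import Data.Bool using (Bool; true; false; if_then_else_; _∧_)
open import Data.List using (List; []; _∷_; concatMap; map; upTo)
open import Data.Vec using (Vec; []; _∷_)

compositions : (n m : ℕ) → List (Vec ℕ n)
compositions zero zero = [] ∷ []
compositions zero (suc m) = []
compositions (suc n) m =
  concatMap (λ a → map (a ∷_) (compositions n (m ∸ a))) (upTo (suc m))

allB : (ℕ → Bool) → ∀ {n} → Vec ℕ n → Bool
allB P [] = true
allB P (a ∷ as) = P a ∧ allB P as

leq1 : ℕ → Bool
leq1 a = a ≤ᵇ 1

anyExp : ℕ → Bool
anyExp a = true

congr01 : ℕ → ℕ → Bool
congr01 s a = (a % suc s) ≤ᵇ 1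

leqS : ℕ → ℕ → Bool
leqS s a = a ≤ᵇ s

module _ {c ℓ} (R : CommutativeRing c ℓ) where
  open CommutativeRing R using (Carrier; _+_; _*_; 0#; 1#)

  pow : Carrier → ℕ → Carrier
  pow x zero = 1#
  pow x (suc k) = x * pow x k

  monomial : ∀ {n} → Vec Carrier n → Vec ℕ n → Carrier
  monomial [] [] = 1#
  monomial (x ∷ xs) (a ∷ as) = pow x a * monomial xs as

  sumL : List Carrier → Carrier
  sumL [] = 0#
  sumL (y ∷ ys) = y + sumL ys

  restrictedSum : (ℕ → Bool) → ∀ {n} → ℕ → Vec Carrier n → Carrier
  restrictedSum P {n} m x =
    sumL (map (λ a → if allB P a then monomial x a else 0#) (compositions n m))

  hSym : ∀ {n} → ℕ → Vec Carrier n → Carrier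
  hSym = restrictedSum anyExp

  eSym : ∀ {n} → ℕ → Vec Carrier n → Carrier
  eSym = restrictedSum leq1

  MSym : ℕ → ∀ {n} → ℕ → Vec Carrier n → Carrier
  MSym s = restrictedSum (congr01 s)

  ESym : ℕ → ∀ {n} → ℕ → Vec Carrier n → Carrier
  ESym s = restrictedSum (leqS s)

  sumTo : ℕ → (ℕ → Carrier) → Carrier
  sumTo zero f = f zero
  sumTo (suc k) f = sumTo k f + f (suc k)

-- Both sides are degree-k coefficients of products of generating series, and every
-- restricted sum factors over the variables into one-variable series. Convolution is
-- associative and commutative, so the identity reduces to a single variable x, where
-- the coefficient of xᵏ on either side counts the splittings k = a + b with a, b
-- admissible exponents. On the left (a ≤ 1) that count is 1 for k = 0 and 2 for
-- k ≥ 1. On the right it is the same: for 1 ≤ k ≤ s the admissible a are exactly 0 and 1,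
-- and for k ≥ s the admissible a form a window of s + 1 consecutive integers, whose
-- count is independent of k because a ↦ a % (s + 1) is periodic.
module Submission where

open import Defs
open import Algebra.Bundles using (CommutativeRing)
open import Data.Bool using (Bool; true; false; if_then_else_; _∧_)
open import Data.Bool.Properties using (∧-identityʳ; ∧-zeroʳ)
open import Data.List using (List; []; _∷_; _++_; concatMap; map; applyUpTo)
open import Data.List.Properties using (map-++; map-∘)
open import Data.Nat using (ℕ; zero; suc; _≤_; _<_; _≤′_; _∸_; _≤ᵇ_; _≤?_; _%_; z≤n; s≤s; ≤′-refl; ≤′-step)
import Data.Nat as ℕ
open import Data.Nat.DivMod using ([m+n]%n≡m%n; m≤n⇒m%n≡m)
open import Data.Nat.Properties using (≤-refl; ≤-trans; ≤-pred; ≤-total; m≤n⇒m≤1+n; m∸[m∸n]≡n; m+[n∸m]≡n; m∸n+n≡m; +-suc; <⇒≱; ≤⇒≤′; ≤′⇒≤)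
open import Data.Sum using (inj₁; inj₂)
open import Data.Vec using (Vec; []; _∷_)
open import Function using (_∘_)
open import Relation.Nullary.Decidable using (dec-true; dec-false)
open import Relation.Binary.PropositionalEquality as ≡ using (_≡_)
import Algebra.Properties.CommutativeSemigroup as CommutativeSemigroupProperties
import Relation.Binary.Reasoning.Setoid as SetoidReasoning

module _ {c ℓ} (R : CommutativeRing c ℓ) where
  open CommutativeRing R hiding (zero)
  open CommutativeSemigroupProperties +-commutativeSemigroup using (interchange)
  open SetoidReasoning setoid

  Seq : Set c
  Seq = ℕ → Carrier

  infix 4 _≋_
  _≋_ : Seq → Seq → Set ℓ
  f ≋ g = ∀ k → f k ≈ g k

  ≋-refl : ∀ {f} → f ≋ f
  ≋-refl _ = refl

  sumTo-cong : ∀ k {f g : Seq} → (∀ j → j ≤ k → f j ≈ g j) → sumTo R k f ≈ sumTo R k g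
  sumTo-cong zero    f≈g = f≈g 0 z≤n
  sumTo-cong (suc k) f≈g =
    +-cong (sumTo-cong k (λ j j≤k → f≈g j (m≤n⇒m≤1+n j≤k))) (f≈g (suc k) ≤-refl)

  sumTo-suc : ∀ k (f : Seq) → sumTo R (suc k) f ≈ f 0 + sumTo R k (f ∘ suc)
  sumTo-suc zero    f = refl
  sumTo-suc (suc k) f = trans (+-cong (sumTo-suc k f) refl) (+-assoc _ _ _)

  sumTo-reverse : ∀ k (f : Seq) → sumTo R k f ≈ sumTo R k (λ j → f (k ∸ j))
  sumTo-reverse zero    f = refl
  sumTo-reverse (suc k) f = begin
    sumTo R k f + f (suc k)                    ≈⟨ +-cong (sumTo-reverse k f) refl ⟩
    sumTo R k (λ j → f (k ∸ j)) + f (suc k)    ≈⟨ +-comm _ _ ⟩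
    f (suc k) + sumTo R k (λ j → f (k ∸ j))    ≈⟨ sumTo-suc k (λ j → f (suc k ∸ j)) ⟨
    sumTo R (suc k) (λ j → f (suc k ∸ j))      ∎

  sumTo-+ : ∀ k (f g : Seq) → sumTo R k (λ j → f j + g j) ≈ sumTo R k f + sumTo R k g
  sumTo-+ zero    f g = refl
  sumTo-+ (suc k) f g = trans (+-cong (sumTo-+ k f g) refl) (interchange _ _ _ _)

  sumTo-*ˡ : ∀ k a (f : Seq) → sumTo R k (λ j → a * f j) ≈ a * sumTo R k f
  sumTo-*ˡ zero    a f = refl
  sumTo-*ˡ (suc k) a f = trans (+-cong (sumTo-*ˡ k a f) refl) (sym (distribˡ _ _ _))

  sumTo-*ʳ : ∀ k a (f : Seq) → sumTo R k (λ j → f j * a) ≈ sumTo R k f * a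
  sumTo-*ʳ zero    a f = refl
  sumTo-*ʳ (suc k) a f = trans (+-cong (sumTo-*ʳ k a f) refl) (sym (distribʳ _ _ _))

  sumTo-truncate : ∀ {m k} (f : Seq) → m ≤′ k → (∀ i → m < i → f i ≈ 0#) →
                   sumTo R k f ≈ sumTo R m f
  sumTo-truncate f ≤′-refl          _      = refl
  sumTo-truncate f (≤′-step m≤′k) vanish =
    trans (+-cong (sumTo-truncate f m≤′k vanish) (vanish _ (s≤s (≤′⇒≤ m≤′k))))
          (+-identityʳ _)

  infixl 7 _⋆_
  _⋆_ : Seq → Seq → Seq
  (f ⋆ g) k = sumTo R k (λ j → f j * g (k ∸ j))

  ⋆-cong : ∀ {f f′ g g′} → f ≋ f′ → g ≋ g′ → f ⋆ g ≋ f′ ⋆ g′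
  ⋆-cong f≋f′ g≋g′ k = sumTo-cong k (λ j _ → *-cong (f≋f′ j) (g≋g′ (k ∸ j)))

  ⋆-comm : ∀ f g → f ⋆ g ≋ g ⋆ f
  ⋆-comm f g k = trans (sumTo-reverse k _) (sumTo-cong k λ j j≤k →
    trans (*-cong refl (reflexive (≡.cong g (m∸[m∸n]≡n j≤k)))) (*-comm _ _))

  ⋆-suc : ∀ f g k → (f ⋆ g) (suc k) ≈ f 0 * g (suc k) + ((f ∘ suc) ⋆ g) k
  ⋆-suc f g k = sumTo-suc k _

  ⋆-distribʳ-+ : ∀ f f′ g → (λ j → f j + f′ j) ⋆ g ≋ (λ k → (f ⋆ g) k + (f′ ⋆ g) k)
  ⋆-distribʳ-+ f f′ g k = trans (sumTo-cong k (λ j _ → distribʳ _ _ _)) (sumTo-+ k _ _)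

  ⋆-*ˡ : ∀ a f g → (λ j → a * f j) ⋆ g ≋ (λ k → a * (f ⋆ g) k)
  ⋆-*ˡ a f g k = trans (sumTo-cong k (λ j _ → *-assoc _ _ _)) (sumTo-*ˡ k a _)

  ⋆-assoc : ∀ f g h → (f ⋆ g) ⋆ h ≋ f ⋆ (g ⋆ h)
  ⋆-assoc f g h zero    = *-assoc _ _ _
  ⋆-assoc f g h (suc k) = begin
    ((f ⋆ g) ⋆ h) (suc k)
      ≈⟨ ⋆-suc (f ⋆ g) h k ⟩
    f 0 * g 0 * h (suc k) + (((f ⋆ g) ∘ suc) ⋆ h) k
      ≈⟨ +-cong refl (⋆-cong (⋆-suc f g) (≋-refl {h}) k) ⟩
    f 0 * g 0 * h (suc k) + ((λ j → f 0 * g (suc j) + ((f ∘ suc) ⋆ g) j) ⋆ h) k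
      ≈⟨ +-cong refl (⋆-distribʳ-+ _ _ h k) ⟩
    f 0 * g 0 * h (suc k) + (((λ j → f 0 * g (suc j)) ⋆ h) k + (((f ∘ suc) ⋆ g) ⋆ h) k)
      ≈⟨ +-cong refl (+-cong (⋆-*ˡ (f 0) (g ∘ suc) h k) (⋆-assoc (f ∘ suc) g h k)) ⟩
    f 0 * g 0 * h (suc k) + (f 0 * ((g ∘ suc) ⋆ h) k + ((f ∘ suc) ⋆ (g ⋆ h)) k)
      ≈⟨ +-assoc _ _ _ ⟨
    f 0 * g 0 * h (suc k) + f 0 * ((g ∘ suc) ⋆ h) k + ((f ∘ suc) ⋆ (g ⋆ h)) k
      ≈⟨ +-cong (trans (+-cong (*-assoc _ _ _) refl) (sym (distribˡ _ _ _))) refl ⟩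
    f 0 * (g 0 * h (suc k) + ((g ∘ suc) ⋆ h) k) + ((f ∘ suc) ⋆ (g ⋆ h)) k
      ≈⟨ +-cong (*-cong refl (⋆-suc g h k)) refl ⟨
    f 0 * (g ⋆ h) (suc k) + ((f ∘ suc) ⋆ (g ⋆ h)) k
      ≈⟨ ⋆-suc f (g ⋆ h) k ⟨
    (f ⋆ (g ⋆ h)) (suc k) ∎

  ⋆-interchange : ∀ f g h i → (f ⋆ g) ⋆ (h ⋆ i) ≋ (f ⋆ h) ⋆ (g ⋆ i)
  ⋆-interchange f g h i k = begin
    ((f ⋆ g) ⋆ (h ⋆ i)) k  ≈⟨ ⋆-assoc f g (h ⋆ i) k ⟩
    (f ⋆ (g ⋆ (h ⋆ i))) k  ≈⟨ ⋆-cong (≋-refl {f}) (λ j → ⋆-assoc g h i j) k ⟨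
    (f ⋆ ((g ⋆ h) ⋆ i)) k  ≈⟨ ⋆-cong (≋-refl {f}) (⋆-cong (⋆-comm g h) (≋-refl {i})) k ⟩
    (f ⋆ ((h ⋆ g) ⋆ i)) k  ≈⟨ ⋆-cong (≋-refl {f}) (⋆-assoc h g i) k ⟩
    (f ⋆ (h ⋆ (g ⋆ i))) k  ≈⟨ ⋆-assoc f h (g ⋆ i) k ⟨
    ((f ⋆ h) ⋆ (g ⋆ i)) k  ∎

  sumL-++ : ∀ (xs ys : List Carrier) → sumL R (xs ++ ys) ≈ sumL R xs + sumL R ys
  sumL-++ []       ys = sym (+-identityˡ _)
  sumL-++ (x ∷ xs) ys = trans (+-cong refl (sumL-++ xs ys)) (sym (+-assoc _ _ _))

  sumL-concatMap : ∀ {A B : Set} (F : B → Carrier) (H : A → List B) (l : List A) →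
    sumL R (map F (concatMap H l)) ≈ sumL R (map (λ a → sumL R (map F (H a))) l)
  sumL-concatMap F H []      = refl
  sumL-concatMap F H (a ∷ l) = begin
    sumL R (map F (H a ++ concatMap H l))
      ≡⟨ ≡.cong (sumL R) (map-++ F (H a) (concatMap H l)) ⟩
    sumL R (map F (H a) ++ map F (concatMap H l))
      ≈⟨ sumL-++ (map F (H a)) (map F (concatMap H l)) ⟩
    sumL R (map F (H a)) + sumL R (map F (concatMap H l))
      ≈⟨ +-cong refl (sumL-concatMap F H l) ⟩
    sumL R (map (λ a → sumL R (map F (H a))) (a ∷ l)) ∎

  sumL-map-applyUpTo : ∀ (F : Seq) (f : ℕ → ℕ) m →
    sumL R (map F (applyUpTo f (suc m))) ≈ sumTo R m (F ∘ f)
  sumL-map-applyUpTo F f zero    = +-identityʳ _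
  sumL-map-applyUpTo F f (suc m) =
    trans (+-cong refl (sumL-map-applyUpTo F (f ∘ suc) m)) (sym (sumTo-suc m (F ∘ f)))

  sumL-map-*ˡ : ∀ {A : Set} (F G : A → Carrier) a → (∀ v → F v ≈ a * G v) →
    ∀ l → sumL R (map F l) ≈ a * sumL R (map G l)
  sumL-map-*ˡ F G a F≈aG []      = sym (zeroʳ _)
  sumL-map-*ˡ F G a F≈aG (v ∷ l) =
    trans (+-cong (F≈aG v) (sumL-map-*ˡ F G a F≈aG l)) (sym (distribˡ _ _ _))

  restrictedSeries : (ℕ → Bool) → ∀ {n} → Vec Carrier n → Seq
  restrictedSeries P xs m = restrictedSum R P m xs

  restrictedPowers : (ℕ → Bool) → Carrier → Seq
  restrictedPowers P x a = if P a then pow R x a else 0#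

  restrictedSeries-[] : ∀ P Q → restrictedSeries P [] ≋ restrictedSeries Q []
  restrictedSeries-[] P Q zero    = refl
  restrictedSeries-[] P Q (suc m) = refl

  restrictedSeries-∷ : ∀ P {n} x (xs : Vec Carrier n) →
    restrictedSeries P (x ∷ xs) ≋ restrictedPowers P x ⋆ restrictedSeries P xs
  restrictedSeries-∷ P {n} x xs m = begin
    sumL R (map F (concatMap H (applyUpTo (λ a → a) (suc m))))
      ≈⟨ sumL-concatMap F H (applyUpTo (λ a → a) (suc m)) ⟩
    sumL R (map (λ a → sumL R (map F (H a))) (applyUpTo (λ a → a) (suc m)))
      ≈⟨ sumL-map-applyUpTo _ (λ a → a) m ⟩
    sumTo R m (λ a → sumL R (map F (H a)))
      ≈⟨ sumTo-cong m (λ a _ → factor a) ⟩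
    (restrictedPowers P x ⋆ restrictedSeries P xs) m ∎
    where
    F : Vec ℕ (suc n) → Carrier
    F v = if allB P v then monomial R (x ∷ xs) v else 0#
    G : Vec ℕ n → Carrier
    G v = if allB P v then monomial R xs v else 0#
    H : ℕ → List (Vec ℕ (suc n))
    H a = map (a ∷_) (compositions n (m ∸ a))
    F-∷ : ∀ a v → F (a ∷ v) ≈ restrictedPowers P x a * G v
    F-∷ a v with P a | allB P v
    ... | true  | true  = refl
    ... | true  | false = sym (zeroʳ _)
    ... | false | _     = sym (zeroˡ _)
    factor : ∀ a → sumL R (map F (H a)) ≈ restrictedPowers P x a * restrictedSeries P xs (m ∸ a)
    factor a = begin
      sumL R (map F (H a))          ≡⟨ ≡.cong (sumL R) (map-∘ (compositions n (m ∸ a))) ⟨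
      sumL R (map (F ∘ (a ∷_)) (compositions n (m ∸ a)))
                                    ≈⟨ sumL-map-*ˡ _ G _ (F-∷ a) (compositions n (m ∸ a)) ⟩
      _                             ∎

  ⟦_⟧ : Bool → Carrier
  ⟦ b ⟧ = if b then 1# else 0#

  pow-+ : ∀ x a b → pow R x (a ℕ.+ b) ≈ pow R x a * pow R x b
  pow-+ x zero    b = sym (*-identityˡ _)
  pow-+ x (suc a) b = trans (*-cong refl (pow-+ x a b)) (sym (*-assoc _ _ _))

  splitCount : (ℕ → Bool) → (ℕ → Bool) → Seq
  splitCount P Q k = sumTo R k (λ j → ⟦ P j ∧ Q (k ∸ j) ⟧)

  restrictedPowers-⋆ : ∀ P Q x →
    restrictedPowers P x ⋆ restrictedPowers Q x ≋ (λ k → splitCount P Q k * pow R x k)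
  restrictedPowers-⋆ P Q x k = trans (sumTo-cong k term) (sumTo-*ʳ k _ _)
    where
    term : ∀ j → j ≤ k →
      restrictedPowers P x j * restrictedPowers Q x (k ∸ j) ≈ ⟦ P j ∧ Q (k ∸ j) ⟧ * pow R x k
    term j j≤k with P j | Q (k ∸ j)
    ... | true  | true  = begin
      pow R x j * pow R x (k ∸ j) ≈⟨ pow-+ x j (k ∸ j) ⟨
      pow R x (j ℕ.+ (k ∸ j))     ≡⟨ ≡.cong (pow R x) (m+[n∸m]≡n j≤k) ⟩
      pow R x k                   ≈⟨ *-identityˡ _ ⟨
      1# * pow R x k              ∎
    ... | true  | false = trans (zeroʳ _) (sym (zeroˡ _))
    ... | false | _     = trans (zeroˡ _) (sym (zeroˡ _))

  sumTo-⟦⟧≈2 : ∀ (P : ℕ → Bool) → P 0 ≡ true → P 1 ≡ true →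
    ∀ k → (∀ j → 2 ≤ j → j ≤ suc k → P j ≡ false) →
    sumTo R (suc k) (⟦_⟧ ∘ P) ≈ 1# + 1#
  sumTo-⟦⟧≈2 P P0 P1 zero    _ rewrite P0 | P1 = refl
  sumTo-⟦⟧≈2 P P0 P1 (suc k) P≥2 =
    trans (+-cong (sumTo-⟦⟧≈2 P P0 P1 k (λ j 2≤j j≤1+k → P≥2 j 2≤j (m≤n⇒m≤1+n j≤1+k)))
                  (reflexive (≡.cong ⟦_⟧ (P≥2 (2 ℕ.+ k) (s≤s (s≤s z≤n)) ≤-refl))))
          (+-identityʳ _)

  splitCount-e-h : ∀ k → splitCount leq1 anyExp (suc k) ≈ 1# + 1#
  splitCount-e-h k = sumTo-⟦⟧≈2 _ ≡.refl ≡.refl k λ where (suc (suc _)) (s≤s (s≤s _)) _ → ≡.refl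

  module _ (s-1 : ℕ) where
    private
      s : ℕ
      s = suc s-1

    leqS-true : ∀ {i} → i ≤ s → leqS s i ≡ true
    leqS-true {i} i≤s = dec-true (i ≤? s) i≤s

    leqS-false : ∀ {i} → s < i → leqS s i ≡ false
    leqS-false {i} s<i = dec-false (i ≤? s) (<⇒≱ s<i)

    congr01-false : ∀ j → 2 ≤ j → j ≤ s → congr01 s j ≡ false
    congr01-false (suc (suc j)) (s≤s (s≤s _)) j≤s rewrite m≤n⇒m%n≡m j≤s = ≡.refl

    congr01-periodic : ∀ k → s ≤ k → congr01 s (suc k) ≡ congr01 s (k ∸ s)
    congr01-periodic k s≤k = ≡.cong (_≤ᵇ 1) (≡.trans
      (≡.cong (_% suc s) (≡.sym (≡.trans (+-suc (k ∸ s) s) (≡.cong suc (m∸n+n≡m s≤k)))))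
      ([m+n]%n≡m%n (k ∸ s) (suc s)))

    splitCount-M-E-small : ∀ k → suc k ≤ s →
                           splitCount (congr01 s) (leqS s) (suc k) ≈ 1# + 1#
    splitCount-M-E-small k 1+k≤s =
      sumTo-⟦⟧≈2 (λ j → congr01 s j ∧ leqS s (suc k ∸ j))
        (leqS-true 1+k≤s) (leqS-true (m≤n⇒m≤1+n (≤-pred 1+k≤s))) k
        λ j 2≤j j≤1+k → ≡.cong (_∧ leqS s (suc k ∸ j)) (congr01-false j 2≤j (≤-trans j≤1+k 1+k≤s))

    window : Seq
    window k = sumTo R s (λ i → ⟦ congr01 s (k ∸ i) ⟧)

    splitCount≈window : ∀ k → s ≤ k → splitCount (congr01 s) (leqS s) k ≈ window k
    splitCount≈window k s≤k = begin
      splitCount (congr01 s) (leqS s) k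
        ≈⟨ sumTo-reverse k _ ⟩
      sumTo R k (λ i → ⟦ congr01 s (k ∸ i) ∧ leqS s (k ∸ (k ∸ i)) ⟧)
        ≈⟨ sumTo-cong k (λ i i≤k → reflexive (≡.cong (term i) (m∸[m∸n]≡n i≤k))) ⟩
      sumTo R k (λ i → term i i)
        ≈⟨ sumTo-truncate (λ i → term i i) (≤⇒≤′ s≤k) term-large ⟩
      sumTo R s (λ i → term i i)
        ≈⟨ sumTo-cong s term-small ⟩
      window k ∎
      where
      term : ℕ → ℕ → Carrier
      term i j = ⟦ congr01 s (k ∸ i) ∧ leqS s j ⟧
      term-large : ∀ i → s < i → term i i ≈ 0#
      term-large i s<i rewrite leqS-false s<i | ∧-zeroʳ (congr01 s (k ∸ i)) = refl
      term-small : ∀ i → i ≤ s → term i i ≈ ⟦ congr01 s (k ∸ i) ⟧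
      term-small i i≤s rewrite leqS-true i≤s | ∧-identityʳ (congr01 s (k ∸ i)) = refl

    window-suc : ∀ k → s ≤ k → window (suc k) ≈ window k
    window-suc k s≤k = begin
      window (suc k)
        ≈⟨ sumTo-suc s-1 _ ⟩
      ⟦ congr01 s (suc k) ⟧ + sumTo R s-1 (λ i → ⟦ congr01 s (k ∸ i) ⟧)
        ≈⟨ +-comm _ _ ⟩
      sumTo R s-1 (λ i → ⟦ congr01 s (k ∸ i) ⟧) + ⟦ congr01 s (suc k) ⟧
        ≡⟨ ≡.cong (λ b → sumTo R s-1 (λ i → ⟦ congr01 s (k ∸ i) ⟧) + ⟦ b ⟧)
                  (congr01-periodic k s≤k) ⟩
      window k ∎

    window-const : ∀ {k} → s ≤′ k → window k ≈ window s
    window-const ≤′-refl          = refl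
    window-const (≤′-step s≤′k) = trans (window-suc _ (≤′⇒≤ s≤′k)) (window-const s≤′k)

    splitCount-M-E : ∀ k → splitCount (congr01 s) (leqS s) (suc k) ≈ 1# + 1#
    splitCount-M-E k with ≤-total (suc k) s
    ... | inj₁ 1+k≤s = splitCount-M-E-small k 1+k≤s
    ... | inj₂ s≤1+k = begin
      splitCount (congr01 s) (leqS s) (suc k) ≈⟨ splitCount≈window (suc k) s≤1+k ⟩
      window (suc k)                          ≈⟨ window-const (≤⇒≤′ s≤1+k) ⟩
      window s                                ≈⟨ splitCount≈window s ≤-refl ⟨
      splitCount (congr01 s) (leqS s) s       ≈⟨ splitCount-M-E-small s-1 ≤-refl ⟩
      1# + 1#                                 ∎

    restrictedPowers-e⋆h≋M⋆E : ∀ x →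
      restrictedPowers leq1 x ⋆ restrictedPowers anyExp x ≋
      restrictedPowers (congr01 s) x ⋆ restrictedPowers (leqS s) x
    restrictedPowers-e⋆h≋M⋆E x k = begin
      (restrictedPowers leq1 x ⋆ restrictedPowers anyExp x) k
        ≈⟨ restrictedPowers-⋆ leq1 anyExp x k ⟩
      splitCount leq1 anyExp k * pow R x k
        ≈⟨ *-cong (counts k) refl ⟩
      splitCount (congr01 s) (leqS s) k * pow R x k
        ≈⟨ restrictedPowers-⋆ (congr01 s) (leqS s) x k ⟨
      (restrictedPowers (congr01 s) x ⋆ restrictedPowers (leqS s) x) k ∎
      where
      counts : splitCount leq1 anyExp ≋ splitCount (congr01 s) (leqS s)
      counts zero    = refl
      counts (suc k) = trans (splitCount-e-h k) (sym (splitCount-M-E k))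

    restrictedSeries-e⋆h≋M⋆E : ∀ {n} (xs : Vec Carrier n) →
      restrictedSeries leq1 xs ⋆ restrictedSeries anyExp xs ≋
      restrictedSeries (congr01 s) xs ⋆ restrictedSeries (leqS s) xs
    restrictedSeries-e⋆h≋M⋆E [] =
      ⋆-cong (restrictedSeries-[] leq1 (congr01 s)) (restrictedSeries-[] anyExp (leqS s))
    restrictedSeries-e⋆h≋M⋆E (x ∷ xs) k = begin
      (e (x ∷ xs) ⋆ h (x ∷ xs)) k
        ≈⟨ ⋆-cong (restrictedSeries-∷ leq1 x xs) (restrictedSeries-∷ anyExp x xs) k ⟩
      ((e₁ ⋆ e xs) ⋆ (h₁ ⋆ h xs)) k  ≈⟨ ⋆-interchange e₁ (e xs) h₁ (h xs) k ⟩
      ((e₁ ⋆ h₁) ⋆ (e xs ⋆ h xs)) k  ≈⟨ ⋆-cong (restrictedPowers-e⋆h≋M⋆E x) (restrictedSeries-e⋆h≋M⋆E xs) k ⟩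
      ((M₁ ⋆ E₁) ⋆ (M xs ⋆ E xs)) k  ≈⟨ ⋆-interchange M₁ E₁ (M xs) (E xs) k ⟩
      ((M₁ ⋆ M xs) ⋆ (E₁ ⋆ E xs)) k
        ≈⟨ ⋆-cong (restrictedSeries-∷ (congr01 s) x xs) (restrictedSeries-∷ (leqS s) x xs) k ⟨
      (M (x ∷ xs) ⋆ E (x ∷ xs)) k ∎
      where
      e h M E : ∀ {m} → Vec Carrier m → Seq
      e = restrictedSeries leq1
      h = restrictedSeries anyExp
      M = restrictedSeries (congr01 s)
      E = restrictedSeries (leqS s)
      e₁ h₁ M₁ E₁ : Seq
      e₁ = restrictedPowers leq1 x
      h₁ = restrictedPowers anyExp x
      M₁ = restrictedPowers (congr01 s) x
      E₁ = restrictedPowers (leqS s) x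

theorem5p4 : ∀ {c ℓ} (R : CommutativeRing c ℓ) (k n s : ℕ) →
    1 ≤ k → 1 ≤ n → 1 ≤ s →
    (x : Vec (CommutativeRing.Carrier R) n) →
    CommutativeRing._≈_ R
      (sumTo R k (λ j → CommutativeRing._*_ R (eSym R j x) (hSym R (k ∸ j) x)))
      (sumTo R k (λ j → CommutativeRing._*_ R (MSym R s j x) (ESym R s (k ∸ j) x)))
theorem5p4 R k n (suc s-1) _ _ _ x = restrictedSeries-e⋆h≋M⋆E R s-1 x k
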